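{- There is an algorithm that, given a context-free grammar $G$, decides whether $L(G)$ is subword-free.
   Context: A word $u$ is a subword of $w$ if $u$ can be obtained from $w$ by deleting some (not necessarily contiguous) letters. A language $L$ is subword-free if no word of $L$ has a subword different from itself that also lies in $L$. -}

module Defs where

open import Data.Nat using (ℕ)
open import Data.Fin using (Fin)
open import Data.List using (List; []; _∷_; _++_; map)
open import Data.Sum using (_⊎_; inj₁; inj₂)
open import Data.Product using (_×_; _,_; ∃)
open import Data.List.Membership.Propositional using (_∈_)
open import Relation.Binary.PropositionalEquality using (_≡_)
open import Relation.Binary.Construct.Closure.ReflexiveTransitive using (Star)
open import Data.List.Relation.Binary.Sublist.Propositional using (_⊆_)

Word : ℕ → Set
Word k = List (Fin k)

Language : ℕ → Set₁
Language k = Word k → Set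

_≼_ : ∀ {k} → Word k → Word k → Set
u ≼ w = u ⊆ w

SubwordFree : ∀ {k} → Language k → Set
SubwordFree L = ∀ u w → L u → L w → u ≼ w → u ≡ w

-- Context-free grammar with terminals Fin k and nonterminals Fin n.
-- Sentential forms are lists over Fin n ⊎ Fin k (inj₁ = nonterminal, inj₂ = terminal).
SententialForm : ℕ → ℕ → Set
SententialForm n k = List (Fin n ⊎ Fin k)

record CFG (k : ℕ) : Set where
  field
    n     : ℕ
    start : Fin n
    rules : List (Fin n × SententialForm n k)
open CFG public

data _⊢_⇒_ {k} (G : CFG k) : SententialForm (n G) k → SententialForm (n G) k → Set where
  step : ∀ α β A γ → (A , γ) ∈ rules G →
         G ⊢ (α ++ (inj₁ A ∷ β)) ⇒ (α ++ (γ ++ β))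

_⊢_⇒*_ : ∀ {k} (G : CFG k) → SententialForm (n G) k → SententialForm (n G) k → Set
G ⊢ α ⇒* β = Star (G ⊢_⇒_) α β

Lang : ∀ {k} → CFG k → Language k
Lang G w = G ⊢ (inj₁ (start G) ∷ []) ⇒* map inj₂ w

-- Let N be the number of nonterminals and M the finite set of yields of parse trees of height
-- at most 2N + 3; M ⊆ L(G), so if L(G) is subword-free then so is M. Conversely, suppose M is
-- subword-free and take a parse tree t of minimal size whose yield is not in M. Then t is tall
-- enough to contain two nested repetitions of nonterminals along one path,
-- t = P[Q[R[Q′[s]]]] with Q, Q′ proper loops. If Q′ does not change the yield, P[Q[R[s]]] is a
-- smaller tree with the same yield. Otherwise P[R[s]] and P[R[Q′[s]]] are smaller than t, so
-- their yields lie in M, and the first is a proper subword of the second. Hence L(G) is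
-- subword-free iff the finite set M is, which is decidable.
module Submission where

open import Defs
open import Data.Nat using (ℕ; zero; suc; _+_; _≤_; _<_; _⊔_; z≤n; s≤s; s≤s⁻¹; _≤?_)
open import Data.Nat.Properties
  using (≤-refl; ≤-trans; <⇒≤; <-trans; ≤-<-trans; <-≤-trans; ≰⇒>; 1+n≰n; +-suc; +-identityʳ;
         n≤1+n; m≤m+n; m≤n+m; +-monoˡ-<; +-monoʳ-<; ⊔-lub; m⊔n≤o⇒m≤o; m⊔n≤o⇒n≤o)
open import Data.Nat.Induction using (<-wellFounded)
open import Data.Fin using (Fin; zero; suc; _≟_) renaming (_<_ to _<ᶠ_)
open import Data.Fin.Properties using (pigeonhole)
open import Data.List using (List; []; _∷_; _++_; map; length; lookup; filter; concatMap; cartesianProductWith)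
open import Data.List.Properties using (++-assoc; ++-identityʳ; ++-cancelˡ; ++-cancelʳ; map-++; ≡-dec)
open import Data.List.Relation.Unary.All as All using (All; []; _∷_)
open import Data.List.Relation.Unary.All.Properties using (¬Any⇒All¬)
open import Data.List.Relation.Unary.Any using (here; any?)
open import Data.List.Relation.Unary.AllPairs using ([]; _∷_)
open import Data.List.Relation.Unary.Unique.Propositional using (Unique)
open import Data.List.Membership.Propositional using (_∈_; lose; find)
open import Data.List.Membership.Propositional.Properties
  using (∈-lookup; ∈-filter⁺; ∈-filter⁻; ∈-concatMap⁺; ∈-concatMap⁻;
         ∈-cartesianProductWith⁺; ∈-cartesianProductWith⁻)
open import Data.List.Relation.Binary.Sublist.Propositional using (_⊆_; ⊆-refl)
open import Data.List.Relation.Binary.Sublist.Propositional.Properties using (++⁺; ++⁺ˡ; ++⁺ʳ)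
import Data.List.Relation.Binary.Sublist.DecPropositional as SublistDec
open import Data.Sum using (_⊎_; inj₁; inj₂)
open import Data.Product using (Σ-syntax; ∃₂; _×_; _,_; proj₁; proj₂)
open import Data.Empty using (⊥)
open import Data.Unit using (⊤; tt)
open import Function using (_∘_)
open import Relation.Nullary using (Dec; yes; no; contradiction)
open import Relation.Nullary.Decidable using (map′; decidable-stable; _→-dec_)
open import Relation.Binary.Definitions using (DecidableEquality)
open import Relation.Binary.PropositionalEquality
open import Relation.Binary.Construct.Closure.ReflexiveTransitive using (ε; _◅_; _◅◅_; gmap)
open import Induction.WellFounded using (Acc; acc)

Unique-lookup-≢ : ∀ {a} {A : Set a} {xs : List A} → Unique xs →
                  ∀ {i j} → i <ᶠ j → lookup xs i ≢ lookup xs j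
Unique-lookup-≢ {xs = _ ∷ _} (x∉xs ∷ _) {zero} {suc j} _ = All.lookup x∉xs (∈-lookup j)
Unique-lookup-≢ {xs = _ ∷ _} (_ ∷ unique) {suc i} {suc j} (s≤s i<j) = Unique-lookup-≢ unique i<j

Unique⇒length≤ : ∀ {n} {xs : List (Fin n)} → Unique xs → length xs ≤ n
Unique⇒length≤ {n} {xs} unique = decidable-stable (length xs ≤? n) λ long →
  let i , j , i<j , same = pigeonhole (≰⇒> long) (lookup xs)
  in Unique-lookup-≢ unique i<j same

_≟ʷ_ : ∀ {k} → DecidableEquality (Word k)
_≟ʷ_ = ≡-dec _≟_

SubwordFree-anti : ∀ {k} {L L′ : Language k} → (∀ {w} → L′ w → L w) → SubwordFree L → SubwordFree L′
SubwordFree-anti L′⊆L free u w u∈L′ w∈L′ = free u w (L′⊆L u∈L′) (L′⊆L w∈L′)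

subwordFree? : ∀ {k} (M : List (Word k)) → Dec (SubwordFree (_∈ M))
subwordFree? {k} M =
  map′ (λ ok u w u∈M w∈M → All.lookup (All.lookup ok u∈M) w∈M)
       (λ free → All.tabulate λ u∈M → All.tabulate λ w∈M → free _ _ u∈M w∈M)
       (All.all? (λ u → All.all? (λ w → (u ⊆? w) →-dec (u ≟ʷ w)) M) M)
  where open SublistDec (_≟_ {k}) using (_⊆?_)

module ParseTrees {k : ℕ} (G : CFG k) where

  -- Parse trees

  N : ℕ
  N = n G

  Symbol : Set
  Symbol = Fin N ⊎ Fin k

  Form : Set
  Form = SententialForm N k

  mutual
    data Tree : Symbol → Set where
      leaf : (a : Fin k) → Tree (inj₂ a)
      node : ∀ {A γ} → (A , γ) ∈ rules G → Forest γ → Tree (inj₁ A)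

    data Forest : Form → Set where
      []  : Forest []
      _∷_ : ∀ {X γ} → Tree X → Forest γ → Forest (X ∷ γ)

  mutual
    yield : ∀ {X} → Tree X → Word k
    yield (leaf a)   = a ∷ []
    yield (node _ F) = yieldᶠ F

    yieldᶠ : ∀ {γ} → Forest γ → Word k
    yieldᶠ []      = []
    yieldᶠ (t ∷ F) = yield t ++ yieldᶠ F

  mutual
    size : ∀ {X} → Tree X → ℕ
    size (leaf _)   = 1
    size (node _ F) = suc (sizeᶠ F)

    sizeᶠ : ∀ {γ} → Forest γ → ℕ
    sizeᶠ []      = 0
    sizeᶠ (t ∷ F) = size t + sizeᶠ F

  mutual
    height : ∀ {X} → Tree X → ℕ
    height (leaf _)   = 0
    height (node _ F) = suc (heightᶠ F)

    heightᶠ : ∀ {γ} → Forest γ → ℕ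
    heightᶠ []      = 0
    heightᶠ (t ∷ F) = height t ⊔ heightᶠ F

  Parse : Symbol → Word k → Set
  Parse X w = Σ[ t ∈ Tree X ] yield t ≡ w

  Parseᶠ : Form → Word k → Set
  Parseᶠ γ w = Σ[ F ∈ Forest γ ] yieldᶠ F ≡ w

  nodeᵖ : ∀ {A γ w} → (A , γ) ∈ rules G → Parseᶠ γ w → Parse (inj₁ A) w
  nodeᵖ r (F , refl) = node r F , refl

  _∷ᵖ_ : ∀ {X γ u v} → Parse X u → Parseᶠ γ v → Parseᶠ (X ∷ γ) (u ++ v)
  (t , refl) ∷ᵖ (F , refl) = t ∷ F , refl

  _++ᵖ_ : ∀ {α β u v} → Parseᶠ α u → Parseᶠ β v → Parseᶠ (α ++ β) (u ++ v)
  ([] , refl)    ++ᵖ q = q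
  (t ∷ F , refl) ++ᵖ q =
    subst (Parseᶠ _) (sym (++-assoc (yield t) (yieldᶠ F) _)) ((t , refl) ∷ᵖ ((F , refl) ++ᵖ q))

  splitᵖ : ∀ α {β w} → Parseᶠ (α ++ β) w → ∃₂ λ u v → Parseᶠ α u × Parseᶠ β v × w ≡ u ++ v
  splitᵖ []      q              = [] , _ , ([] , refl) , q , refl
  splitᵖ (_ ∷ α) (t ∷ F , refl) =
    let u , v , qα , qβ , eq = splitᵖ α (F , refl)
    in yield t ++ u , v , (t , refl) ∷ᵖ qα , qβ ,
       trans (cong (yield t ++_) eq) (sym (++-assoc (yield t) u v))

  terminalsᵖ : ∀ w → Parseᶠ (map inj₂ w) w
  terminalsᵖ []      = [] , refl
  terminalsᵖ (a ∷ w) = (leaf a , refl) ∷ᵖ terminalsᵖ w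

  -- Parse trees versus derivations

  infix 4 _⇒_ _⇒*_

  _⇒_ : Form → Form → Set
  α ⇒ β = G ⊢ α ⇒ β

  _⇒*_ : Form → Form → Set
  α ⇒* β = G ⊢ α ⇒* β

  ⇒-++ˡ : ∀ l {α β} → α ⇒ β → l ++ α ⇒ l ++ β
  ⇒-++ˡ l (step α β A γ r) =
    subst₂ _⇒_ (++-assoc l α (inj₁ A ∷ β)) (++-assoc l α (γ ++ β)) (step (l ++ α) β A γ r)

  ⇒-++ʳ : ∀ r {α β} → α ⇒ β → α ++ r ⇒ β ++ r
  ⇒-++ʳ r (step α β A γ p) =
    subst₂ _⇒_ (sym (++-assoc α (inj₁ A ∷ β) r))
               (sym (trans (++-assoc α (γ ++ β) r) (cong (α ++_) (++-assoc γ β r))))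
               (step α (β ++ r) A γ p)

  ⇒*-++ˡ : ∀ l {α β} → α ⇒* β → l ++ α ⇒* l ++ β
  ⇒*-++ˡ l = gmap (l ++_) (⇒-++ˡ l)

  ⇒*-++ʳ : ∀ r {α β} → α ⇒* β → α ++ r ⇒* β ++ r
  ⇒*-++ʳ r = gmap (_++ r) (⇒-++ʳ r)

  rule⇒ : ∀ {A γ} → (A , γ) ∈ rules G → inj₁ A ∷ [] ⇒ γ
  rule⇒ {A} {γ} r = subst (inj₁ A ∷ [] ⇒_) (++-identityʳ γ) (step [] [] A γ r)

  mutual
    tree⇒* : ∀ {X} (t : Tree X) → X ∷ [] ⇒* map inj₂ (yield t)
    tree⇒* (leaf _)   = ε
    tree⇒* (node r F) = rule⇒ r ◅ forest⇒* F

    forest⇒* : ∀ {γ} (F : Forest γ) → γ ⇒* map inj₂ (yieldᶠ F)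
    forest⇒* []                = ε
    forest⇒* {X ∷ γ} (t ∷ F) =
      subst (X ∷ γ ⇒*_) (sym (map-++ inj₂ (yield t) (yieldᶠ F)))
        (⇒*-++ʳ γ (tree⇒* t) ◅◅ ⇒*-++ˡ (map inj₂ (yield t)) (forest⇒* F))

  unstep : ∀ {α β w} → α ⇒ β → Parseᶠ β w → Parseᶠ α w
  unstep (step α β A γ r) q
    with _ , _ , qα , qγβ , refl ← splitᵖ α q
    with _ , _ , qγ , qβ , refl ← splitᵖ γ qγβ
    = qα ++ᵖ (nodeᵖ r qγ ∷ᵖ qβ)

  unstep* : ∀ {α β w} → α ⇒* β → Parseᶠ β w → Parseᶠ α w
  unstep* ε        q = q
  unstep* (s ◅ ss) q = unstep s (unstep* ss q)

  Lang⇒Parse : ∀ {w} → Lang G w → Parse (inj₁ (start G)) w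
  Lang⇒Parse {w} derivation with unstep* derivation (terminalsᵖ w)
  ... | t ∷ [] , eq = t , trans (sym (++-identityʳ (yield t))) eq

  Parse⇒Lang : ∀ {w} → Parse (inj₁ (start G)) w → Lang G w
  Parse⇒Lang (t , refl) = tree⇒* t

  -- One-hole contexts

  mutual
    data Ctx : Symbol → Symbol → Set where
      hole : ∀ {X} → Ctx X X
      node : ∀ {A γ Y} → (A , γ) ∈ rules G → Ctxᶠ γ Y → Ctx (inj₁ A) Y

    data Ctxᶠ : Form → Symbol → Set where
      here  : ∀ {X γ Y} → Ctx X Y → Forest γ → Ctxᶠ (X ∷ γ) Y
      there : ∀ {X γ Y} → Tree X → Ctxᶠ γ Y → Ctxᶠ (X ∷ γ) Y

  mutual
    plug : ∀ {X Y} → Ctx X Y → Tree Y → Tree X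
    plug hole        u = u
    plug (node r fc) u = node r (plugᶠ fc u)

    plugᶠ : ∀ {γ Y} → Ctxᶠ γ Y → Tree Y → Forest γ
    plugᶠ (here C F)   u = plug C u ∷ F
    plugᶠ (there t fc) u = t ∷ plugᶠ fc u

  mutual
    _⊙_ : ∀ {X Y Z} → Ctx X Y → Ctx Y Z → Ctx X Z
    hole      ⊙ D = D
    node r fc ⊙ D = node r (fc ⊙ᶠ D)

    _⊙ᶠ_ : ∀ {γ Y Z} → Ctxᶠ γ Y → Ctx Y Z → Ctxᶠ γ Z
    here C F   ⊙ᶠ D = here (C ⊙ D) F
    there t fc ⊙ᶠ D = there t (fc ⊙ᶠ D)

  mutual
    plug-⊙ : ∀ {X Y Z} (C : Ctx X Y) (D : Ctx Y Z) u → plug (C ⊙ D) u ≡ plug C (plug D u)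
    plug-⊙ hole        D u = refl
    plug-⊙ (node r fc) D u = cong (node r) (plugᶠ-⊙ᶠ fc D u)

    plugᶠ-⊙ᶠ : ∀ {γ Y Z} (C : Ctxᶠ γ Y) (D : Ctx Y Z) u → plugᶠ (C ⊙ᶠ D) u ≡ plugᶠ C (plug D u)
    plugᶠ-⊙ᶠ (here C F)   D u = cong (_∷ F) (plug-⊙ C D u)
    plugᶠ-⊙ᶠ (there t fc) D u = cong (t ∷_) (plugᶠ-⊙ᶠ fc D u)

  Proper : ∀ {X Y} → Ctx X Y → Set
  Proper hole       = ⊥
  Proper (node _ _) = ⊤

  ⊙-proper : ∀ {X Y Z} (C : Ctx X Y) (D : Ctx Y Z) → Proper C → Proper (C ⊙ D)
  ⊙-proper (node _ _) D _ = tt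

  mutual
    yieldˡ : ∀ {X Y} → Ctx X Y → Word k
    yieldˡ hole        = []
    yieldˡ (node _ fc) = yieldˡᶠ fc

    yieldˡᶠ : ∀ {γ Y} → Ctxᶠ γ Y → Word k
    yieldˡᶠ (here C _)   = yieldˡ C
    yieldˡᶠ (there t fc) = yield t ++ yieldˡᶠ fc

  mutual
    yieldʳ : ∀ {X Y} → Ctx X Y → Word k
    yieldʳ hole        = []
    yieldʳ (node _ fc) = yieldʳᶠ fc

    yieldʳᶠ : ∀ {γ Y} → Ctxᶠ γ Y → Word k
    yieldʳᶠ (here C F)   = yieldʳ C ++ yieldᶠ F
    yieldʳᶠ (there _ fc) = yieldʳᶠ fc

  mutual
    yield-plug : ∀ {X Y} (C : Ctx X Y) u → yield (plug C u) ≡ yieldˡ C ++ yield u ++ yieldʳ C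
    yield-plug hole        u = sym (++-identityʳ (yield u))
    yield-plug (node _ fc) u = yieldᶠ-plugᶠ fc u

    yieldᶠ-plugᶠ : ∀ {γ Y} (C : Ctxᶠ γ Y) u → yieldᶠ (plugᶠ C u) ≡ yieldˡᶠ C ++ yield u ++ yieldʳᶠ C
    yieldᶠ-plugᶠ (here C F) u = begin
      yield (plug C u) ++ yieldᶠ F              ≡⟨ cong (_++ yieldᶠ F) (yield-plug C u) ⟩
      (l ++ yield u ++ r) ++ yieldᶠ F           ≡⟨ ++-assoc l (yield u ++ r) (yieldᶠ F) ⟩
      l ++ (yield u ++ r) ++ yieldᶠ F           ≡⟨ cong (l ++_) (++-assoc (yield u) r (yieldᶠ F)) ⟩
      l ++ yield u ++ r ++ yieldᶠ F             ∎
      where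
      open ≡-Reasoning
      l = yieldˡ C
      r = yieldʳ C
    yieldᶠ-plugᶠ (there t fc) u =
      trans (cong (yield t ++_) (yieldᶠ-plugᶠ fc u)) (sym (++-assoc (yield t) (yieldˡᶠ fc) _))

  yield-plug-cong : ∀ {X Y} (C : Ctx X Y) {a b} → yield a ≡ yield b → yield (plug C a) ≡ yield (plug C b)
  yield-plug-cong C {a} {b} eq =
    trans (yield-plug C a)
      (trans (cong (λ w → yieldˡ C ++ w ++ yieldʳ C) eq) (sym (yield-plug C b)))

  yield-plug-cancel : ∀ {X Y} (C : Ctx X Y) {a b} → yield (plug C a) ≡ yield (plug C b) → yield a ≡ yield b
  yield-plug-cancel C {a} {b} eq =
    ++-cancelʳ (yieldʳ C) _ _
      (++-cancelˡ (yieldˡ C) _ _ (trans (sym (yield-plug C a)) (trans eq (yield-plug C b))))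

  yield-plug-mono : ∀ {X Y} (C : Ctx X Y) {a b} → yield a ⊆ yield b → yield (plug C a) ⊆ yield (plug C b)
  yield-plug-mono C {a} {b} a⊆b =
    subst₂ _⊆_ (sym (yield-plug C a)) (sym (yield-plug C b)) (framed {yieldˡ C} {yieldʳ C} a⊆b)
    where
    framed : ∀ {l r u v : Word k} → u ⊆ v → l ++ u ++ r ⊆ l ++ v ++ r
    framed {l} {r} u⊆v = ++⁺ {as = l} {bs = l} ⊆-refl (++⁺ {cs = r} {ds = r} u⊆v ⊆-refl)

  yield-⊆-yield-plug : ∀ {X Y} (C : Ctx X Y) u → yield u ⊆ yield (plug C u)
  yield-⊆-yield-plug C u =
    subst (yield u ⊆_) (sym (yield-plug C u)) (++⁺ˡ (yieldˡ C) (++⁺ʳ (yieldʳ C) ⊆-refl))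

  mutual
    size-≤-plug : ∀ {X Y} (C : Ctx X Y) u → size u ≤ size (plug C u)
    size-≤-plug hole        u = ≤-refl
    size-≤-plug (node _ fc) u = ≤-trans (size-≤-plugᶠ fc u) (n≤1+n _)

    size-≤-plugᶠ : ∀ {γ Y} (C : Ctxᶠ γ Y) u → size u ≤ sizeᶠ (plugᶠ C u)
    size-≤-plugᶠ (here C _)   u = ≤-trans (size-≤-plug C u) (m≤m+n _ _)
    size-≤-plugᶠ (there _ fc) u = ≤-trans (size-≤-plugᶠ fc u) (m≤n+m _ _)

  size-<-plug : ∀ {X Y} (C : Ctx X Y) → Proper C → ∀ u → size u < size (plug C u)
  size-<-plug (node _ fc) _ u = s≤s (size-≤-plugᶠ fc u)

  mutual
    size-plug-mono : ∀ {X Y} (C : Ctx X Y) {a b} → size a < size b → size (plug C a) < size (plug C b)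
    size-plug-mono hole        a<b = a<b
    size-plug-mono (node _ fc) a<b = s≤s (size-plugᶠ-mono fc a<b)

    size-plugᶠ-mono : ∀ {γ Y} (C : Ctxᶠ γ Y) {a b} → size a < size b → sizeᶠ (plugᶠ C a) < sizeᶠ (plugᶠ C b)
    size-plugᶠ-mono (here C _)   a<b = +-monoˡ-< _ (size-plug-mono C a<b)
    size-plugᶠ-mono (there t fc) a<b = +-monoʳ-< (size t) (size-plugᶠ-mono fc a<b)

  -- Pumping

  tallestChild : ∀ {γ} (F : Forest γ) → 0 < heightᶠ F →
                 Σ[ Z ∈ Symbol ] Σ[ fc ∈ Ctxᶠ γ Z ] Σ[ c ∈ Tree Z ] plugᶠ fc c ≡ F × heightᶠ F ≤ height c
  tallestChild (t ∷ F) positive with heightᶠ F ≤? height t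
  ... | yes F≤t = _ , here hole F , t , refl , ⊔-lub ≤-refl F≤t
  ... | no F≰t  =
    let t<F = ≰⇒> F≰t
        Z , fc , c , eq , F≤c = tallestChild F (≤-<-trans z≤n t<F)
    in Z , there t fc , c , cong (t ∷_) eq , ⊔-lub (≤-trans (<⇒≤ t<F) F≤c) F≤c

  record Pumping {X} (t : Tree X) (m : ℕ) : Set where
    field
      {B}           : Fin N
      outer         : Ctx X (inj₁ B)
      loop          : Ctx (inj₁ B) (inj₁ B)
      inner         : Tree (inj₁ B)
      loop-proper   : Proper loop
      decomposition : t ≡ plug outer (plug loop inner)
      inner-tall    : m ≤ height inner

  -- Walk down the tallest branch, recording for every nonterminal met so far how the path
  -- context splits at it. By seen-count the steps f run out only after N + 1 distinct
  -- nonterminals, which Unique⇒length≤ rules out; so some nonterminal repeats first.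
  module Descent {X} (t : Tree X) (m : ℕ) where

    record Passed {Y} (C : Ctx X Y) (B : Fin N) : Set where
      field
        above        : Ctx X (inj₁ B)
        below        : Ctx (inj₁ B) Y
        below-proper : Proper below
        splits       : ∀ u → plug above (plug below u) ≡ plug C u

    extend : ∀ {Y Z B} {C : Ctx X Y} (E : Ctx Y Z) → Passed C B → Passed (C ⊙ E) B
    extend {C = C} E record { above = P ; below = Q ; below-proper = Q-proper ; splits = splits } =
      record
        { above        = P
        ; below        = Q ⊙ E
        ; below-proper = ⊙-proper Q E Q-proper
        ; splits       = λ u → begin
            plug P (plug (Q ⊙ E) u)   ≡⟨ cong (plug P) (plug-⊙ Q E u) ⟩
            plug P (plug Q (plug E u)) ≡⟨ splits (plug E u) ⟩
            plug C (plug E u)         ≡⟨ sym (plug-⊙ C E u) ⟩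
            plug (C ⊙ E) u            ∎
        }
      where open ≡-Reasoning

    record State (f : ℕ) : Set where
      field
        {Y}         : Symbol
        path        : Ctx X Y
        current     : Tree Y
        reaches     : plug path current ≡ t
        tall        : m + f < height current
        seen        : List (Fin N)
        seen-unique : Unique seen
        seen-count  : length seen + f ≡ suc N
        seen-passed : All (Passed path) seen

    advance : ∀ {f} → State (suc f) → Pumping t m ⊎ State f
    advance {f} record { path = C ; current = node {A} r F ; reaches = reaches ; tall = tall
                    ; seen = seen ; seen-unique = unique ; seen-count = count ; seen-passed = passed }
      with any? (A ≟_) seen
    ... | yes A∈seen =
      let record { above = P ; below = Q ; below-proper = Q-proper ; splits = splits } =
            All.lookup passed A∈seen
      in inj₁ record
        { outer         = P
        ; loop          = Q
        ; inner         = node r F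
        ; loop-proper   = Q-proper
        ; decomposition = sym (trans (splits (node r F)) reaches)
        ; inner-tall    = ≤-trans (m≤m+n m (suc f)) (<⇒≤ tall)
        }
    ... | no A∉seen =
      let tall′ = subst (_≤ heightᶠ F) (+-suc m f) (s≤s⁻¹ tall)
          _ , fc , c , plug-c , F≤c = tallestChild F (≤-<-trans z≤n tall′)
          E = node r fc
      in inj₂ record
        { path        = C ⊙ E
        ; current     = c
        ; reaches     = trans (plug-⊙ C E c) (trans (cong (plug C ∘ node r) plug-c) reaches)
        ; tall        = <-≤-trans tall′ F≤c
        ; seen        = A ∷ seen
        ; seen-unique = ¬Any⇒All¬ seen A∉seen ∷ unique
        ; seen-count  = trans (sym (+-suc (length seen) f)) count
        ; seen-passed = record { above = C ; below = E ; below-proper = tt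
                               ; splits = λ u → sym (plug-⊙ C E u) }
                        ∷ All.map (extend E) passed
        }

    descend : ∀ {f} → State f → Pumping t m
    descend {zero} s =
      contradiction (subst (_≤ N) (trans (sym (+-identityʳ _)) (State.seen-count s))
                                  (Unique⇒length≤ (State.seen-unique s)))
                    1+n≰n
    descend {suc f} s with advance s
    ... | inj₁ found = found
    ... | inj₂ s′    = descend s′

  pumping : ∀ {X} (t : Tree X) {m} → m + suc N < height t → Pumping t m
  pumping t {m} tall = descend record
    { path = hole ; current = t ; reaches = refl ; tall = tall
    ; seen = [] ; seen-unique = [] ; seen-count = refl ; seen-passed = [] }
    where open Descent t m

  record DoublePumping {X} (t : Tree X) : Set where
    field
      {A B}         : Fin N
      outer         : Ctx X (inj₁ B)
      loop₁         : Ctx (inj₁ B) (inj₁ B)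
      middle        : Ctx (inj₁ B) (inj₁ A)
      loop₂         : Ctx (inj₁ A) (inj₁ A)
      inner         : Tree (inj₁ A)
      loop₁-proper  : Proper loop₁
      loop₂-proper  : Proper loop₂
      decomposition : t ≡ plug outer (plug loop₁ (plug middle (plug loop₂ inner)))

  pumpingHeight : ℕ
  pumpingHeight = suc (suc N) + suc N

  doublePumping : ∀ {X} (t : Tree X) → pumpingHeight < height t → DoublePumping t
  doublePumping t tall =
    let record { outer = P ; loop = Q ; inner = c ; loop-proper = Q-proper
               ; decomposition = t≡ ; inner-tall = c-tall } = pumping t {suc (suc N)} tall
        record { outer = R ; loop = Q′ ; inner = s ; loop-proper = Q′-proper
               ; decomposition = c≡ } = pumping c {0} c-tall
    in record
      { outer = P ; loop₁ = Q ; middle = R ; loop₂ = Q′ ; inner = s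
      ; loop₁-proper = Q-proper ; loop₂-proper = Q′-proper
      ; decomposition = trans t≡ (cong (plug P ∘ plug Q) c≡) }

  -- Yields of parse trees of bounded height

  products : (Symbol → List (Word k)) → Form → List (Word k)
  products ys []      = [] ∷ []
  products ys (X ∷ γ) = cartesianProductWith _++_ (ys X) (products ys γ)

  rulesFor : Fin N → List (Fin N × Form)
  rulesFor A = filter (λ r → proj₁ r ≟ A) (rules G)

  yieldsUpTo : ℕ → Symbol → List (Word k)
  yieldsUpTo _       (inj₂ a) = (a ∷ []) ∷ []
  yieldsUpTo zero    (inj₁ A) = []
  yieldsUpTo (suc h) (inj₁ A) = concatMap (products (yieldsUpTo h) ∘ proj₂) (rulesFor A)

  mutual
    yieldsUpTo⁺ : ∀ {h X} (t : Tree X) → height t ≤ h → yield t ∈ yieldsUpTo h X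
    yieldsUpTo⁺ (leaf _) _ = here refl
    yieldsUpTo⁺ {suc h} (node {A} r F) (s≤s F≤h) =
      ∈-concatMap⁺ (products (yieldsUpTo h) ∘ proj₂)
        (lose (∈-filter⁺ (λ r → proj₁ r ≟ A) r refl) (products⁺ F F≤h))

    products⁺ : ∀ {h γ} (F : Forest γ) → heightᶠ F ≤ h → yieldᶠ F ∈ products (yieldsUpTo h) γ
    products⁺ []      _    = here refl
    products⁺ (t ∷ F) F≤h =
      ∈-cartesianProductWith⁺ _++_ (yieldsUpTo⁺ t (m⊔n≤o⇒m≤o _ _ F≤h))
                                   (products⁺ F (m⊔n≤o⇒n≤o _ _ F≤h))

  products⁻ : ∀ {ys} → (∀ {X w} → w ∈ ys X → Parse X w) → ∀ γ {w} → w ∈ products ys γ → Parseᶠ γ w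
  products⁻ parse [] (here refl) = [] , refl
  products⁻ {ys} parse (X ∷ γ) w∈
    with _ , _ , u∈ , v∈ , refl ← ∈-cartesianProductWith⁻ _++_ (ys X) (products ys γ) w∈
    = parse u∈ ∷ᵖ products⁻ parse γ v∈

  yieldsUpTo⁻ : ∀ h {X w} → w ∈ yieldsUpTo h X → Parse X w
  yieldsUpTo⁻ _       {inj₂ a} (here refl) = leaf a , refl
  yieldsUpTo⁻ (suc h) {inj₁ A} w∈
    with (_ , γ) , r∈rulesFor , w∈γ ← find (∈-concatMap⁻ (products (yieldsUpTo h) ∘ proj₂) w∈)
    with r∈rules , refl ← ∈-filter⁻ (λ r → proj₁ r ≟ A) r∈rulesFor
    = nodeᵖ r∈rules (products⁻ (yieldsUpTo⁻ h) γ w∈γ)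

  shortYields : List (Word k)
  shortYields = yieldsUpTo pumpingHeight (inj₁ (start G))

  shortYields⊆Lang : ∀ {w} → w ∈ shortYields → Lang G w
  shortYields⊆Lang = Parse⇒Lang ∘ yieldsUpTo⁻ pumpingHeight

  module _ (free : SubwordFree (_∈ shortYields)) where

    yield-∈-shortYields : (t : Tree (inj₁ (start G))) → Acc _<_ (size t) → yield t ∈ shortYields
    yield-∈-shortYields t (acc smaller) with height t ≤? pumpingHeight
    ... | yes low = yieldsUpTo⁺ t low
    ... | no high with doublePumping t (≰⇒> high)
    ... | record { outer = P ; loop₁ = Q ; middle = R ; loop₂ = Q′ ; inner = s
                 ; loop₁-proper = Q-proper ; loop₂-proper = Q′-proper ; decomposition = refl }
      with yield (plug Q′ s) ≟ʷ yield s
    ... | yes Q′-silent =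
      subst (_∈ shortYields) (yield-plug-cong P (yield-plug-cong Q (yield-plug-cong R (sym Q′-silent))))
            (yield-∈-shortYields pumpedDown (smaller pumpedDown<t))
      where
      pumpedDown : Tree (inj₁ (start G))
      pumpedDown = plug P (plug Q (plug R s))
      pumpedDown<t : size pumpedDown < size t
      pumpedDown<t = size-plug-mono P (size-plug-mono Q (size-plug-mono R (size-<-plug Q′ Q′-proper s)))
    ... | no Q′-visible = contradiction
      (sym (yield-plug-cancel R (yield-plug-cancel P
        (free _ _ (yield-∈-shortYields withoutBoth (smaller (<-trans withoutBoth<withoutQ withoutQ<t)))
                  (yield-∈-shortYields withoutQ (smaller withoutQ<t))
                  (yield-plug-mono P (yield-plug-mono R (yield-⊆-yield-plug Q′ s)))))))
      Q′-visible
      where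
      withoutQ withoutBoth : Tree (inj₁ (start G))
      withoutQ    = plug P (plug R (plug Q′ s))
      withoutBoth = plug P (plug R s)
      withoutQ<t : size withoutQ < size t
      withoutQ<t = size-plug-mono P (size-<-plug Q Q-proper _)
      withoutBoth<withoutQ : size withoutBoth < size withoutQ
      withoutBoth<withoutQ = size-plug-mono P (size-plug-mono R (size-<-plug Q′ Q′-proper s))

    Lang⊆shortYields : ∀ {w} → Lang G w → w ∈ shortYields
    Lang⊆shortYields Lw with t , refl ← Lang⇒Parse Lw = yield-∈-shortYields t (<-wellFounded (size t))

theorem19 : (k : ℕ) → (G : CFG k) → Dec (SubwordFree (Lang G))
theorem19 k G =
  map′ (λ free → SubwordFree-anti (Lang⊆shortYields free) free)
       (SubwordFree-anti shortYields⊆Lang)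
       (subwordFree? shortYields)
  where open ParseTrees G
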